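{- For a unitary magma $\mathcal{M}$, the rewrite rule $\to$ is terminating: there is no infinite sequence $\mathfrak{t}\Rightarrow\mathfrak{t}_1\Rightarrow\mathfrak{t}_2\Rightarrow\cdots$ of one-step rewritings of syntax trees on $\mathcal{T}_\mathcal{M}$.
   Context: A unitary magma $\mathcal{M}$ is a set with binary operation $\star$ and two-sided unit $1_\mathcal{M}$. $\mathcal{T}_\mathcal{M}$ is the set of $\mathcal{M}$-triangles (triangles whose base, first edge and second edge are labeled by elements of $\mathcal{M}$); $\mathrm{T}(a,b,c)$ denotes the triangle with labels $a$ (base), $b$ (first edge), $c$ (second edge). Syntax trees on $\mathcal{T}_\mathcal{M}$ are planar binary trees whose internal nodes are labeled by triangles; $x\circ_i y$ denotes the tree with root labeled $x$ whose $i$th child is an internal node labeled $y$ (both other children leaves). The rewrite rule $\to$ is given, for all $p_j,q_j\in\mathcal{M}$, by: $\mathrm{T}(p_0,p_1,p_2)\circ_1\mathrm{T}(q_0,q_1,q_2)\to\mathrm{T}(p_0,p_1\star q_0,p_2)\circ_1\mathrm{T}(1_\mathcal{M},q_1,q_2)$ if $q_0\neq1_\mathcal{M}$; $\mathrm{T}(p_0,p_1,p_2)\circ_1\mathrm{T}(q_0,q_1,q_2)\to\mathrm{T}(p_0,q_1,1_\mathcal{M})\circ_2\mathrm{T}(1_\mathcal{M},q_2,p_2)$ if $p_1\star q_0=1_\mathcal{M}$; $\mathrm{T}(p_0,p_1,p_2)\circ_2\mathrm{T}(q_0,q_1,q_2)\to\mathrm{T}(p_0,p_1,p_2\star q_0)\circ_2\mathrm{T}(1_\mathcal{M},q_1,q_2)$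 if $q_0\neq1_\mathcal{M}$. A tree $\mathfrak{t}$ rewrites in one step into $\mathfrak{t}'$ ($\mathfrak{t}\Rightarrow\mathfrak{t}'$) if $\mathfrak{t}'$ is obtained by replacing an occurrence in $\mathfrak{t}$ of a left-hand side of $\to$ (a subtree pattern, whose leaves may be superimposed with internal nodes of $\mathfrak{t}$) by the corresponding right-hand side. -}

module Defs where

open import Level using (Level; suc)
open import Relation.Binary.PropositionalEquality using (_≡_)
open import Relation.Nullary using (¬_)

record UnitaryMagma (c : Level) : Set (suc c) where
  infixl 7 _⋆_
  field
    Carrier   : Set c
    _⋆_       : Carrier → Carrier → Carrier
    𝟙         : Carrier
    identityˡ : ∀ x → 𝟙 ⋆ x ≡ x
    identityʳ : ∀ x → x ⋆ 𝟙 ≡ x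

module _ {c : Level} (M : UnitaryMagma c) where
  open UnitaryMagma M

  record Triangle : Set c where
    constructor T
    field
      base  : Carrier
      edge₁ : Carrier
      edge₂ : Carrier

  data Tree : Set c where
    leaf : Tree
    node : Triangle → Tree → Tree → Tree

  -- One-step rewriting t ⇒ t'.  The patterns x ∘ᵢ y have their leaves
  -- superimposed with arbitrary subtrees (a, b, d below, in planar order).
  data _⇒_ : Tree → Tree → Set c where
    rule₁ : ∀ {p₀ p₁ p₂ q₀ q₁ q₂} {a b d} → ¬ (q₀ ≡ 𝟙) →
      node (T p₀ p₁ p₂) (node (T q₀ q₁ q₂) a b) d
        ⇒ node (T p₀ (p₁ ⋆ q₀) p₂) (node (T 𝟙 q₁ q₂) a b) d
    rule₂ : ∀ {p₀ p₁ p₂ q₀ q₁ q₂} {a b d} → p₁ ⋆ q₀ ≡ 𝟙 →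
      node (T p₀ p₁ p₂) (node (T q₀ q₁ q₂) a b) d
        ⇒ node (T p₀ q₁ 𝟙) a (node (T 𝟙 q₂ p₂) b d)
    rule₃ : ∀ {p₀ p₁ p₂ q₀ q₁ q₂} {a b d} → ¬ (q₀ ≡ 𝟙) →
      node (T p₀ p₁ p₂) a (node (T q₀ q₁ q₂) b d)
        ⇒ node (T p₀ p₁ (p₂ ⋆ q₀)) a (node (T 𝟙 q₁ q₂) b d)
    inˡ : ∀ {x l l' r} → l ⇒ l' → node x l r ⇒ node x l' r
    inʳ : ∀ {x l r r'} → r ⇒ r' → node x l r ⇒ node x l r'

{-# OPTIONS --safe #-}
-- Weigh a tree by the number of its nodes whose base is not 𝟙 plus, over
-- all nodes, the size of the left subtree.  Rules 1 and 3 keep the shape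
-- and turn a non-unit base into 𝟙, so they lose exactly 1.  Rule 2 is a
-- right rotation x(y(a,b),d) ↦ x(a,y'(b,d)) whose new node y' has base 𝟙;
-- the left subtrees of x and y, of sizes 1+|a|+|b| and |a|, become a and b,
-- so the weight drops by at least 1+|a|.  Equality with 𝟙 need not be
-- decidable, so the weight lives on trees annotated with these decisions;
-- as the theorem is a negation, excluded middle may supply them.
module Submission where

open import Defs
open import Level using (Level)
open import Data.Nat using (ℕ; suc; _+_; _<_; z<s)
open import Data.Nat.Induction using (<-wellFounded)
open import Data.Nat.Properties
  using (n<1+n; m<n+m; ≤-reflexive; +-monoˡ-<; +-monoʳ-<; +-mono-≤-<; module ≤-Reasoning)
open import Data.Nat.Tactic.RingSolver using (solve-∀)
open import Data.Product using (Σ; Σ-syntax; _,_)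
open import Data.Unit using (tt)
open import Effect.Monad using (RawMonad)
open import Function using (_∘_; _on_)
open import Induction.WellFounded using (WellFounded)
open import Induction.InfiniteDescent using (Descent; descent∧wf⇒empty)
import Relation.Binary.Construct.On as On
open import Relation.Binary.Core using (Rel)
open import Relation.Binary.PropositionalEquality using (_≡_; refl; cong)
open import Relation.Nullary using (¬_; Dec; yes; no; contradiction)
open import Relation.Nullary.Decidable using (¬¬-excluded-middle)
open import Relation.Nullary.Negation using (¬¬-Monad)
open import Relation.Unary using (Pred; U)

module _ {a p r} {A : Set a} {_⟶_ : Rel A r}
         (P : Pred A p) (weight : ∀ {x} → P x → ℕ)
         (lighter : ∀ {x y} → x ⟶ y → (px : P x) → Σ[ py ∈ P y ] weight py < weight px)
         where

  no-infinite-chain-from : (f : ℕ → A) → (∀ n → f n ⟶ f (suc n)) → ¬ P (f 0)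
  no-infinite-chain-from f chain p₀ = descent∧wf⇒empty descent ≺-wellFounded (0 , p₀) tt
    where
    weightAt : Σ ℕ (P ∘ f) → ℕ
    weightAt (_ , px) = weight px

    ≺-wellFounded : WellFounded (_<_ on weightAt)
    ≺-wellFounded = On.wellFounded weightAt <-wellFounded

    descent : Descent (_<_ on weightAt) U
    descent {n , px} _ with py , py<px ← lighter (chain n) px = (suc n , py) , py<px , tt

rotation-lighter : ∀ n₀ n₁ a b wa wb wd →
  n₀ + a + wa + (b + wb + wd) < n₀ + suc (a + b) + (n₁ + a + wa + wb) + wd
rotation-lighter n₀ n₁ a b wa wb wd = begin-strict
  n₀ + a + wa + (b + wb + wd)                           <⟨ m<n+m _ {suc (n₁ + a)} z<s ⟩
  suc (n₁ + a) + (n₀ + a + wa + (b + wb + wd))          ≡⟨ regroup n₀ n₁ a b wa wb wd ⟩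
  n₀ + suc (a + b) + (n₁ + a + wa + wb) + wd            ∎
  where
  open ≤-Reasoning
  regroup : ∀ n₀ n₁ a b wa wb wd →
    suc (n₁ + a) + (n₀ + a + wa + (b + wb + wd)) ≡ n₀ + suc (a + b) + (n₁ + a + wa + wb) + wd
  regroup = solve-∀

module _ {c : Level} (M : UnitaryMagma c) where
  open UnitaryMagma M
  open RawMonad (¬¬-Monad {a = c}) using (pure; _>>=_)

  data BaseDecided : Tree M → Set c where
    leaf : BaseDecided leaf
    node : ∀ {x e₁ e₂ l r} → Dec (x ≡ 𝟙) → BaseDecided l → BaseDecided r →
           BaseDecided (node (T x e₁ e₂) l r)

  decide-bases : ∀ t → ¬ ¬ BaseDecided t
  decide-bases leaf = pure leaf
  decide-bases (node _ l r) = do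
    d ← ¬¬-excluded-middle
    dl ← decide-bases l
    dr ← decide-bases r
    pure (node d dl dr)

  nonUnit : ∀ {x} → Dec (x ≡ 𝟙) → ℕ
  nonUnit (yes _) = 0
  nonUnit (no _) = 1

  size : Tree M → ℕ
  size leaf = 0
  size (node _ l r) = suc (size l + size r)

  weight : ∀ {t} → BaseDecided t → ℕ
  weight leaf = 0
  weight (node {l = l} d dl dr) = nonUnit d + size l + weight dl + weight dr

  size-preserved : ∀ {t t'} → _⇒_ M t t' → size t' ≡ size t
  size-preserved (rule₁ _) = refl
  size-preserved (rule₂ {a = a} {b} {d} _) = rotation-size (size a) (size b) (size d)
    where
    rotation-size : ∀ a b d → suc (a + suc (b + d)) ≡ suc (suc (a + b) + d)
    rotation-size = solve-∀
  size-preserved (rule₃ _) = refl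
  size-preserved (inˡ {r = r} s) = cong (λ n → suc (n + size r)) (size-preserved s)
  size-preserved (inʳ {l = l} s) = cong (λ n → suc (size l + n)) (size-preserved s)

  -- A node decided `no` weighs `suc` of the same node decided `yes`, hence the `n<1+n`.
  ⇒-lighter : ∀ {t t'} → _⇒_ M t t' → (d : BaseDecided t) →
            Σ[ d' ∈ BaseDecided t' ] weight d' < weight d
  ⇒-lighter (rule₁ q₀≢𝟙) (node _ (node (yes q₀≡𝟙) _ _) _) = contradiction q₀≡𝟙 q₀≢𝟙
  ⇒-lighter (rule₁ _) (node d₀ (node (no _) da db) dd) =
    node d₀ (node (yes refl) da db) dd , +-monoˡ-< (weight dd) (+-monoʳ-< _ (n<1+n _))
  ⇒-lighter (rule₂ {a = a} {b} _) (node d₀ (node d₁ da db) dd) =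
    node d₀ da (node (yes refl) db dd) ,
    rotation-lighter (nonUnit d₀) (nonUnit d₁) (size a) (size b) (weight da) (weight db) (weight dd)
  ⇒-lighter (rule₃ q₀≢𝟙) (node _ _ (node (yes q₀≡𝟙) _ _)) = contradiction q₀≡𝟙 q₀≢𝟙
  ⇒-lighter (rule₃ _) (node d₀ da (node (no _) db dd)) =
    node d₀ da (node (yes refl) db dd) , +-monoʳ-< _ (n<1+n _)
  ⇒-lighter (inˡ s) (node d dl dr) with dl' , dl'<dl ← ⇒-lighter s dl =
    node d dl' dr ,
    +-monoˡ-< (weight dr) (+-mono-≤-< (≤-reflexive (cong (nonUnit d +_) (size-preserved s))) dl'<dl)
  ⇒-lighter (inʳ s) (node d dl dr) with dr' , dr'<dr ← ⇒-lighter s dr =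
    node d dl dr' , +-monoʳ-< _ dr'<dr

lemma3p11 : ∀ {c : Level} (M : UnitaryMagma c) →
    ¬ (Σ (ℕ → Tree M) (λ f → ∀ n → _⇒_ M (f n) (f (suc n))))
lemma3p11 M (f , chain) =
  decide-bases M (f 0) (no-infinite-chain-from (BaseDecided M) (weight M) (⇒-lighter M) f chain)
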